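{- For every integer $k\geq 3$, $$S(F_k)=\begin{cases} 0 & \text{if } k\equiv 0,3\pmod 6,\\ \tfrac12 & \text{if } k\equiv 2,4\pmod 6,\\ -\tfrac12 & \text{if } k\equiv 1,5\pmod 6.\end{cases}$$
   Context: The Fibonacci numbers are defined by $F_0=0$, $F_1=1$ and $F_m=F_{m-1}+F_{m-2}$ for $m\geq 2$. For each integer $n\geq 1$, the Fibonacci-sum graph $G_n$ is the simple graph with vertex set $\{1,\dots,n\}$ in which distinct vertices $i,j$ are adjacent iff $i+j$ is a Fibonacci number. Each $G_n$ is connected and bipartite, so it has a unique proper $2$-colouring $c_n:\{1,\dots,n\}\to\{0,1\}$ with $c_n(1)=1$, and these are compatible ($c_{n'}$ restricts to $c_n$ for $n'\geq n$). Define $c(i)=c_n(i)$ for any $n\geq i$. For $N\geq 1$ let $S(N)=\sum_{i=1}^N c(i)-\tfrac{N}{2}$, and $S(0)=0$. -}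

module Defs where

open import Data.Nat using (ℕ; zero; suc; _+_; _≤_; _%_)
open import Data.Bool using (Bool; true; false)
open import Data.Product using (∃)
open import Relation.Binary.PropositionalEquality using (_≡_; _≢_)
open import Data.Integer using (+_)
open import Data.Rational using (ℚ; _-_; _/_; 0ℚ; ½; -½)

F : ℕ → ℕ
F zero = zero
F (suc zero) = suc zero
F (suc (suc m)) = F (suc m) + F m

IsFib : ℕ → Set
IsFib m = ∃ λ t → F t ≡ m

Adj : ℕ → ℕ → ℕ → Set
Adj n i j = (1 ≤ i) × (i ≤ n) × (1 ≤ j) × (j ≤ n) × (i ≢ j) × IsFib (i + j)
  where open import Data.Product using (_×_)

-- c is a proper 2-colouring of G_n (colour 1 = true, colour 0 = false)
-- (values of c outside {1,…,n} are irrelevant)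
Proper2Colouring : ℕ → (ℕ → Bool) → Set
Proper2Colouring n c = ∀ i j → Adj n i j → c i ≢ c j

countOnes : (ℕ → Bool) → ℕ → ℕ
countOnes c zero = zero
countOnes c (suc N) with c (suc N)
... | true  = suc (countOnes c N)
... | false = countOnes c N

S : (ℕ → Bool) → ℕ → ℚ
S c N = (+ countOnes c N / 1) - (+ N / 2)

target : ℕ → ℚ
target k with k % 6
... | 0 = 0ℚ
... | 3 = 0ℚ
... | 2 = ½
... | 4 = ½
... | _ = -½

module Submission where

-- Let n = F k and let c be the proper 2-colouring of G_n with c 1 = 1.
--  * Mirror pairs.  Since n itself is a Fibonacci number, i and n - i are
--    adjacent for 1 ≤ i < n/2, so they get opposite colours.  Hence the
--    vertices 1 … n-1 contribute exactly (n-1)/2 ones when n is odd, and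
--    n/2 - 1 + c(n/2) ones when n is even (the middle vertex is unpaired).
--  * Colours along Fibonacci chains.  Consecutive Fibonacci numbers, and
--    consecutive halves F(3j)/2 of the even Fibonacci numbers, sum to a
--    Fibonacci number, so colours alternate along both chains; both start
--    at 1.  Thus c(F m) = [m even] and c(F(3j)/2) = [j odd].
--  * F m is even iff 3 ∣ m.  For odd n this gives S(n) = c(n) - 1/2 = ±1/2
--    according to the parity of k; for k = 3(j+1) the two unpaired vertices
--    n/2 and n have opposite colours, so S(n) = 0.
-- The file develops the arithmetic of F, the counting lemma for colourings
-- that are antisymmetric under i ↦ n - i, the alternation lemma, the value
-- of target on each residue class of k mod 3, and finally lemma6.

open import Defs
open import Data.Nat using (ℕ; zero; suc; _+_; _≤_; _<_; _≤′_; ≤′-refl; ≤′-step; z≤n; s≤s)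
open import Data.Nat.Properties
open import Data.Nat.Tactic.RingSolver using (solve-∀)
open import Data.Bool using (Bool; true; false; not)
open import Data.Bool.Properties using (¬-not; not-involutive)
open import Data.Product using (Σ; _,_)
open import Data.Integer as ℤ using (+_)
import Data.Integer.Tactic.RingSolver as ℤ-Solver
open import Data.Rational using (ℚ; _-_; _/_; 0ℚ; ½; -½; toℚᵘ)
open import Data.Rational.Properties using (toℚᵘ-injective; toℚᵘ-homo-+; toℚᵘ-homo‿-; toℚᵘ-fromℚᵘ)
import Data.Rational.Unnormalised as ℚᵘ
import Data.Rational.Unnormalised.Properties as ℚᵘ
open import Relation.Binary.PropositionalEquality
open ≡-Reasoning

isEven : ℕ → Bool
isEven zero = true
isEven (suc zero) = false
isEven (suc (suc m)) = isEven m

isEven-suc : ∀ m → isEven (suc m) ≡ not (isEven m)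
isEven-suc zero = refl
isEven-suc (suc zero) = refl
isEven-suc (suc (suc m)) = isEven-suc m

Odd : ℕ → Set
Odd n = Σ ℕ λ h → n ≡ suc (h + h)

-- triple j = 3j, defined so that triple (suc j) unfolds to three successors.
triple : ℕ → ℕ
triple zero = zero
triple (suc j) = suc (suc (suc (triple j)))

isEven-triple : ∀ j → isEven (triple j) ≡ isEven j
isEven-triple zero = refl
isEven-triple (suc j) = begin
  isEven (suc (suc (suc (triple j)))) ≡⟨ isEven-suc (triple j) ⟩
  not (isEven (triple j))             ≡⟨ cong not (isEven-triple j) ⟩
  not (isEven j)                      ≡⟨ isEven-suc j ⟨
  isEven (suc j)                      ∎

triple-monotone : ∀ {i j} → i ≤ j → triple i ≤ triple j
triple-monotone z≤n = z≤n
triple-monotone (s≤s i≤j) = s≤s (s≤s (s≤s (triple-monotone i≤j)))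

triple-gap : ∀ {i j} → i < j → 2 + triple (suc i) ≤ triple (suc j)
triple-gap i<j = ≤-trans (s≤s (s≤s (triple-monotone i<j))) (n≤1+n _)

data Residue3 : ℕ → Set where
  ≡0 : ∀ j → Residue3 (triple j)
  ≡1 : ∀ j → Residue3 (suc (triple j))
  ≡2 : ∀ j → Residue3 (suc (suc (triple j)))

residue3 : ∀ k → Residue3 k
residue3 zero = ≡0 zero
residue3 (suc k) with residue3 k
... | ≡0 j = ≡1 j
... | ≡1 j = ≡2 j
... | ≡2 j = ≡0 (suc j)

-- target (6 + k) reduces to target k, so each statement is proved by
-- checking two base cases and recursing in steps of two.

halfSign : Bool → ℚ
halfSign true = ½
halfSign false = -½

target-triple : ∀ j → target (triple j) ≡ 0ℚ
target-triple zero = refl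
target-triple (suc zero) = refl
target-triple (suc (suc j)) = target-triple j

target-triple+2 : ∀ j → target (2 + triple j) ≡ halfSign (isEven (triple j))
target-triple+2 zero = refl
target-triple+2 (suc zero) = refl
target-triple+2 (suc (suc j)) = target-triple+2 j

target-triple+4 : ∀ j → target (4 + triple j) ≡ halfSign (isEven (triple j))
target-triple+4 zero = refl
target-triple+4 (suc zero) = refl
target-triple+4 (suc (suc j)) = target-triple+4 j

-- Fibonacci arithmetic

F-positive : ∀ m → 1 ≤ F (suc m)
F-positive zero = ≤-refl
F-positive (suc m) = ≤-trans (F-positive m) (m≤m+n _ _)

F-step : ∀ m → F m ≤ F (suc m)
F-step zero = z≤n
F-step (suc zero) = ≤-refl
F-step (suc (suc m)) = m≤m+n _ _

F-monotone : ∀ {m m'} → m ≤ m' → F m ≤ F m'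
F-monotone m≤m' = along (≤⇒≤′ m≤m')
  where
  along : ∀ {m m'} → m ≤′ m' → F m ≤ F m'
  along ≤′-refl = ≤-refl
  along (≤′-step {m'} m≤′m') = ≤-trans (along m≤′m') (F-step m')

F-increasing : ∀ m → F (2 + m) < F (3 + m)
F-increasing m = m<m+n (F (2 + m)) (F-positive m)

-- half j = F(3j)/2, built from F(3j+3) = 2 F(3j+1) + F(3j).
half : ℕ → ℕ
half zero = zero
half (suc j) = F (suc (triple j)) + half j

F-triple : ∀ j → F (triple j) ≡ half j + half j
F-triple zero = refl
F-triple (suc j) = begin
  F (suc (suc (triple j))) + F (suc (triple j))
    ≡⟨ cong (λ z → x + z + x) (F-triple j) ⟩
  x + (half j + half j) + x
    ≡⟨ regroup x (half j) ⟩
  (x + half j) + (x + half j) ∎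
  where
  x : ℕ
  x = F (suc (triple j))
  regroup : ∀ x h → x + (h + h) + x ≡ (x + h) + (x + h)
  regroup = solve-∀

-- Two consecutive halves sum to a Fibonacci number: F(3j) + F(3j+3) = 2 F(3j+2).
half-consecutive : ∀ j → half j + half (suc j) ≡ F (2 + triple j)
half-consecutive j = begin
  half j + (F (suc (triple j)) + half j) ≡⟨ +-comm (half j) _ ⟩
  F (suc (triple j)) + half j + half j    ≡⟨ +-assoc (F (suc (triple j))) _ _ ⟩
  F (suc (triple j)) + (half j + half j)  ≡⟨ cong (λ z → F (suc (triple j)) + z) (F-triple j) ⟨
  F (2 + triple j)                        ∎

half-below : ∀ j → half (suc j) ≤ F (2 + triple j)
half-below j = subst (half (suc j) ≤_) (half-consecutive j) (m≤n+m (half (suc j)) (half j))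

half-positive : ∀ j → 1 ≤ half (suc j)
half-positive j = ≤-trans (F-positive (triple j)) (m≤m+n _ _)

half-increasing : ∀ j → half (suc j) < half (2 + j)
half-increasing j = m<n+m (half (suc j)) (F-positive (triple (suc j)))

F-odd₁ : ∀ j → Odd (F (suc (triple j)))
F-odd₁ zero = 0 , refl
F-odd₁ (suc j) with F-odd₁ j
... | a , odd = x + a , (begin
  (x + F (suc (triple j))) + x ≡⟨ cong (λ z → (x + z) + x) odd ⟩
  (x + suc (a + a)) + x        ≡⟨ regroup x a ⟩
  suc ((x + a) + (x + a))      ∎)
  where
  x : ℕ
  x = F (2 + triple j)
  regroup : ∀ x a → (x + suc (a + a)) + x ≡ suc ((x + a) + (x + a))
  regroup = solve-∀

F-odd₂ : ∀ j → Odd (F (2 + triple j))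
F-odd₂ j with F-odd₁ j
... | a , odd = a + half j , (begin
  F (suc (triple j)) + F (triple j) ≡⟨ cong₂ _+_ odd (F-triple j) ⟩
  suc (a + a) + (half j + half j)   ≡⟨ regroup a (half j) ⟩
  suc ((a + half j) + (a + half j)) ∎)
  where
  regroup : ∀ a h → suc (a + a) + (h + h) ≡ suc ((a + h) + (a + h))
  regroup = solve-∀

bit : Bool → ℕ
bit true = 1
bit false = 0

difference-unnormalised : ∀ a b →
  toℚᵘ ((+ a / 1) - (+ b / 2)) ℚᵘ.≃ (ℚᵘ.mkℚᵘ (+ a) 0 ℚᵘ.- ℚᵘ.mkℚᵘ (+ b) 1)
difference-unnormalised a b = ℚᵘ.≃-trans (toℚᵘ-homo-+ (+ a / 1) _)
  (ℚᵘ.+-cong (toℚᵘ-fromℚᵘ (ℚᵘ.mkℚᵘ (+ a) 0))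
    (ℚᵘ.≃-trans (toℚᵘ-homo‿- (+ b / 2)) (ℚᵘ.-‿cong (toℚᵘ-fromℚᵘ (ℚᵘ.mkℚᵘ (+ b) 1)))))

value-odd : ∀ b h → (+ (bit b + h) / 1) - (+ suc (h + h) / 2) ≡ halfSign b
value-odd true h = toℚᵘ-injective
  (ℚᵘ.≃-trans (difference-unnormalised (suc h) (suc (h + h))) (ℚᵘ.*≡* (cross (+ h))))
  where
  cross : ∀ X → ((+ 1 ℤ.+ X) ℤ.* + 2 ℤ.+ (ℤ.- (+ 1 ℤ.+ (X ℤ.+ X))) ℤ.* + 1) ℤ.* + 2
              ≡ + 1 ℤ.* (+ 1 ℤ.* + 2)
  cross = ℤ-Solver.solve-∀
value-odd false h = toℚᵘ-injective
  (ℚᵘ.≃-trans (difference-unnormalised h (suc (h + h))) (ℚᵘ.*≡* (cross (+ h))))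
  where
  cross : ∀ X → (X ℤ.* + 2 ℤ.+ (ℤ.- (+ 1 ℤ.+ (X ℤ.+ X))) ℤ.* + 1) ℤ.* + 2
              ≡ ℤ.-[1+ 0 ] ℤ.* (+ 1 ℤ.* + 2)
  cross = ℤ-Solver.solve-∀

value-even : ∀ g → (+ suc g / 1) - (+ (suc g + suc g) / 2) ≡ 0ℚ
value-even g = toℚᵘ-injective
  (ℚᵘ.≃-trans (difference-unnormalised (suc g) (suc g + suc g)) (ℚᵘ.*≡* (cross (+ g))))
  where
  cross : ∀ X → ((+ 1 ℤ.+ X) ℤ.* + 2 ℤ.+ (ℤ.- ((+ 1 ℤ.+ X) ℤ.+ (+ 1 ℤ.+ X))) ℤ.* + 1) ℤ.* + 1
              ≡ + 0 ℤ.* (+ 1 ℤ.* + 2)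
  cross = ℤ-Solver.solve-∀

-- Counting ones of colourings antisymmetric under i ↦ n - i

Antipodal : ℕ → (ℕ → Bool) → Set
Antipodal n c = ∀ {i j} → 1 ≤ i → i < j → i + j ≡ n → c j ≡ not (c i)

module Counting (c : ℕ → Bool) where

  count-suc : ∀ N → countOnes c (suc N) ≡ bit (c (suc N)) + countOnes c N
  count-suc N with c (suc N)
  ... | true = refl
  ... | false = refl

  -- The blocks (a, a+t] and (b, b+t] are mirror images under i ↦ n - i, and
  -- each mirror pair contributes exactly one 1.
  mirror-count : ∀ {n} → Antipodal n c → ∀ t a b → a + t ≤ b → suc (a + t + b) ≡ n →
    countOnes c (b + t) + countOnes c (a + t) ≡ countOnes c b + countOnes c a + t
  mirror-count _ zero a b _ _ = begin
    countOnes c (b + 0) + countOnes c (a + 0)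
      ≡⟨ cong₂ (λ x y → countOnes c x + countOnes c y) (+-identityʳ b) (+-identityʳ a) ⟩
    countOnes c b + countOnes c a
      ≡⟨ +-identityʳ _ ⟨
    countOnes c b + countOnes c a + 0 ∎
  mirror-count anti (suc t) a b bound sum = begin
    countOnes c (b + suc t) + countOnes c (a + suc t)
      ≡⟨ cong₂ (λ x y → countOnes c x + countOnes c y) (+-suc b t) (+-suc a t) ⟩
    countOnes c (suc (b + t)) + countOnes c (suc a + t)
      ≡⟨ cong (_+ countOnes c (suc a + t)) (count-suc (b + t)) ⟩
    y + countOnes c (b + t) + countOnes c (suc a + t)
      ≡⟨ +-assoc y _ _ ⟩
    y + (countOnes c (b + t) + countOnes c (suc a + t))
      ≡⟨ cong (λ z → y + z) inner ⟩
    y + (countOnes c b + countOnes c (suc a) + t)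
      ≡⟨ cong (λ z → y + (countOnes c b + z + t)) (count-suc a) ⟩
    y + (countOnes c b + (x + countOnes c a) + t)
      ≡⟨ regroup y (countOnes c b) x (countOnes c a) t ⟩
    (x + y) + (countOnes c b + countOnes c a + t)
      ≡⟨ cong (λ z → x + bit z + (countOnes c b + countOnes c a + t)) pair ⟩
    (x + bit (not (c (suc a)))) + (countOnes c b + countOnes c a + t)
      ≡⟨ cong (_+ (countOnes c b + countOnes c a + t)) (one-of (c (suc a))) ⟩
    suc (countOnes c b + countOnes c a + t)
      ≡⟨ +-suc _ t ⟨
    countOnes c b + countOnes c a + suc t ∎
    where
    regroup : ∀ y B x A t → y + (B + (x + A) + t) ≡ (x + y) + (B + A + t)
    regroup = solve-∀
    reorder : ∀ a b t → a + (b + suc t) ≡ a + suc t + b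
    reorder = solve-∀
    x : ℕ
    x = bit (c (suc a))
    y : ℕ
    y = bit (c (suc (b + t)))
    one-of : ∀ v → bit v + bit (not v) ≡ 1
    one-of true = refl
    one-of false = refl
    shifted : suc a + t ≡ a + suc t
    shifted = sym (+-suc a t)
    inner : countOnes c (b + t) + countOnes c (suc a + t) ≡ countOnes c b + countOnes c (suc a) + t
    inner = mirror-count anti t (suc a) b (subst (_≤ b) (sym shifted) bound)
                         (trans (cong (λ z → suc (z + b)) shifted) sum)
    a<b+t : a < b + t
    a<b+t = ≤-trans (≤-trans (s≤s (m≤m+n a t)) (subst (_≤ b) (+-suc a t) bound)) (m≤m+n b t)
    pair : c (suc (b + t)) ≡ not (c (suc a))
    pair = anti (s≤s z≤n) (s≤s a<b+t)
      (trans (cong suc (trans (cong (λ z → a + z) (sym (+-suc b t)))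
                (reorder a b t))) sum)

  -- n = 2h + 1: the vertices 1 … 2h split into h mirror pairs.
  count-odd : ∀ h → Antipodal (suc (h + h)) c →
    countOnes c (suc (h + h)) ≡ bit (c (suc (h + h))) + h
  count-odd h anti = trans (count-suc (h + h)) (cong (λ z → bit (c (suc (h + h))) + z) pairs)
    where
    pairs : countOnes c (h + h) ≡ h
    pairs = +-cancelʳ-≡ (countOnes c h) _ _ (begin
      countOnes c (h + h) + countOnes c h ≡⟨ mirror-count anti h 0 h ≤-refl refl ⟩
      countOnes c h + 0 + h               ≡⟨ cong (_+ h) (+-identityʳ _) ⟩
      countOnes c h + h                   ≡⟨ +-comm (countOnes c h) h ⟩
      h + countOnes c h                   ∎)

  -- n = 2(g + 1): g mirror pairs, plus the unpaired middle vertex g + 1 and n.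
  count-even : ∀ g → Antipodal (suc g + suc g) c →
    countOnes c (suc g + suc g) ≡ bit (c (suc g + suc g)) + (bit (c (suc g)) + g)
  count-even g anti = begin
    countOnes c (suc g + suc g)                              ≡⟨ count-suc (g + suc g) ⟩
    bit (c (suc g + suc g)) + countOnes c (g + suc g)        ≡⟨ cong (λ z → bit (c (suc g + suc g)) + countOnes c z) (+-suc g g) ⟩
    bit (c (suc g + suc g)) + countOnes c (suc (g + g))      ≡⟨ cong (λ z → bit (c (suc g + suc g)) + z) pairs ⟩
    bit (c (suc g + suc g)) + (bit (c (suc g)) + g)          ∎
    where
    middle : ℕ
    middle = bit (c (suc g))
    regroup : ∀ x C g → x + C + 0 + g ≡ (x + g) + C
    regroup = solve-∀
    pairs : countOnes c (suc (g + g)) ≡ middle + g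
    pairs = +-cancelʳ-≡ (countOnes c g) _ _ (begin
      countOnes c (suc (g + g)) + countOnes c g ≡⟨ mirror-count anti g 0 (suc g) (n≤1+n g) refl ⟩
      countOnes c (suc g) + 0 + g               ≡⟨ cong (λ z → z + 0 + g) (count-suc g) ⟩
      middle + countOnes c g + 0 + g            ≡⟨ regroup middle _ g ⟩
      middle + g + countOnes c g                ∎)

  S-odd : ∀ {n} → Odd n → Antipodal n c → S c n ≡ halfSign (c n)
  S-odd (h , refl) anti = begin
    (+ countOnes c (suc (h + h)) / 1) - (+ suc (h + h) / 2)
      ≡⟨ cong (λ z → (+ z / 1) - (+ suc (h + h) / 2)) (count-odd h anti) ⟩
    (+ (bit (c (suc (h + h))) + h) / 1) - (+ suc (h + h) / 2)
      ≡⟨ value-odd (c (suc (h + h))) h ⟩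
    halfSign (c (suc (h + h))) ∎

  S-even : ∀ {n} m → n ≡ m + m → 1 ≤ m → Antipodal n c → c m ≡ not (c n) → S c n ≡ 0ℚ
  S-even (suc g) refl _ anti opposite = begin
    (+ countOnes c n / 1) - (+ n / 2)
      ≡⟨ cong (λ z → (+ z / 1) - (+ n / 2)) (count-even g anti) ⟩
    (+ (bit (c n) + (bit (c (suc g)) + g)) / 1) - (+ n / 2)
      ≡⟨ cong (λ z → (+ (bit (c n) + (bit z + g)) / 1) - (+ n / 2)) opposite ⟩
    (+ (bit (c n) + (bit (not (c n)) + g)) / 1) - (+ n / 2)
      ≡⟨ cong (λ z → (+ z / 1) - (+ n / 2)) (complement (c n)) ⟩
    (+ suc g / 1) - (+ n / 2)
      ≡⟨ value-even g ⟩
    0ℚ ∎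
    where
    n : ℕ
    n = suc g + suc g
    complement : ∀ v → bit v + (bit (not v) + g) ≡ suc g
    complement true = refl
    complement false = refl

alternating : ∀ {c : ℕ → Bool} (u : ℕ → ℕ) (L : ℕ) → c (u 0) ≡ true →
  (∀ m → m < L → c (u (suc m)) ≡ not (c (u m))) → ∀ m → m ≤ L → c (u m) ≡ isEven m
alternating u L start step zero _ = start
alternating {c} u L start step (suc m) m<L = begin
  c (u (suc m))  ≡⟨ step m m<L ⟩
  not (c (u m))  ≡⟨ cong not (alternating {c} u L start step m (<⇒≤ m<L)) ⟩
  not (isEven m) ≡⟨ isEven-suc m ⟨
  isEven (suc m) ∎

-- Proper colourings of the Fibonacci-sum graph

module Proper {n : ℕ} {c : ℕ → Bool} (proper : Proper2Colouring n c) where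

  adjacent-colours : ∀ {i j} → 1 ≤ i → i < j → j ≤ n → IsFib (i + j) → c j ≡ not (c i)
  adjacent-colours 1≤i i<j j≤n fib = ¬-not (≢-sym (proper _ _
    (1≤i , ≤-trans (<⇒≤ i<j) j≤n , ≤-trans 1≤i (<⇒≤ i<j) , j≤n , <⇒≢ i<j , fib)))

  antipodal : IsFib n → Antipodal n c
  antipodal (t , Ft≡n) {i} {j} 1≤i i<j i+j≡n =
    adjacent-colours 1≤i i<j (subst (j ≤_) i+j≡n (m≤n+m j i)) (t , trans Ft≡n (sym i+j≡n))

-- The colour of 1 propagates along the two Fibonacci chains inside G_{F k}.
module FibonacciColouring {k : ℕ} {c : ℕ → Bool}
         (proper : Proper2Colouring (F k) c) (c1 : c 1 ≡ true) where
  open Proper proper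

  colour-F : ∀ L → 2 + L ≤ k → c (F (2 + L)) ≡ isEven L
  colour-F L 2+L≤k = alternating {c} (λ m → F (2 + m)) L c1 step L ≤-refl
    where
    step : ∀ m → m < L → c (F (3 + m)) ≡ not (c (F (2 + m)))
    step m m<L = adjacent-colours (F-positive (suc m)) (F-increasing m)
      (F-monotone (≤-trans (s≤s (s≤s m<L)) 2+L≤k)) (4 + m , +-comm (F (3 + m)) (F (2 + m)))

  colour-half : ∀ j → triple (suc j) ≤ k → c (half (suc j)) ≡ isEven j
  colour-half j 3j+3≤k = alternating {c} (λ i → half (suc i)) j c1 step j ≤-refl
    where
    step : ∀ i → i < j → c (half (2 + i)) ≡ not (c (half (suc i)))
    step i i<j = adjacent-colours (half-positive i) (half-increasing i)
      (≤-trans (half-below (suc i)) (F-monotone (≤-trans (triple-gap i<j) 3j+3≤k)))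
      (2 + triple (suc i) , sym (half-consecutive (suc i)))

S-at-odd-F : ∀ L {c} → Proper2Colouring (F (2 + L)) c → c 1 ≡ true →
  Odd (F (2 + L)) → S c (F (2 + L)) ≡ halfSign (isEven L)
S-at-odd-F L {c} proper c1 odd = begin
  S c (F (2 + L))             ≡⟨ S-odd odd (antipodal (2 + L , refl)) ⟩
  halfSign (c (F (2 + L)))    ≡⟨ cong halfSign (colour-F L ≤-refl) ⟩
  halfSign (isEven L)         ∎
  where open Counting c
        open Proper proper
        open FibonacciColouring {2 + L} proper c1

-- k = 3(j+1): the middle vertex F k / 2 and F k have opposite colours, so S(F k) = 0.
S-at-even-F : ∀ j {c} → Proper2Colouring (F (triple (suc j))) c → c 1 ≡ true →
  S c (F (triple (suc j))) ≡ 0ℚ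
S-at-even-F j {c} proper c1 =
  S-even (half (suc j)) (F-triple (suc j)) (half-positive j) (antipodal (triple (suc j) , refl)) opposite
  where
  open Counting c
  open Proper proper
  open FibonacciColouring {triple (suc j)} proper c1
  opposite : c (half (suc j)) ≡ not (c (F (triple (suc j))))
  opposite = begin
    c (half (suc j))                   ≡⟨ colour-half j ≤-refl ⟩
    isEven j                           ≡⟨ not-involutive (isEven j) ⟨
    not (not (isEven j))               ≡⟨ cong not (trans (isEven-suc (triple j)) (cong not (isEven-triple j))) ⟨
    not (isEven (suc (triple j)))      ≡⟨ cong not (colour-F (suc (triple j)) ≤-refl) ⟨
    not (c (F (triple (suc j))))       ∎

lemma6 : (k : ℕ) → 3 ≤ k → (c : ℕ → Bool) →
    Proper2Colouring (F k) c → c 1 ≡ true → S c (F k) ≡ target k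
lemma6 k 3≤k c proper c1 with residue3 k
lemma6 _ () c proper c1 | ≡0 zero
lemma6 _ (s≤s ()) c proper c1 | ≡1 zero
... | ≡0 (suc j) = trans (S-at-even-F j proper c1) (sym (target-triple (suc j)))
... | ≡1 (suc j) =
  trans (S-at-odd-F (2 + triple j) proper c1 (F-odd₁ (suc j))) (sym (target-triple+4 j))
... | ≡2 j = trans (S-at-odd-F (triple j) proper c1 (F-odd₂ j)) (sym (target-triple+2 j))
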